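{- Every arrangement $\mathcal{A}$ of $n\ge 3$ pseudolines admits a sequence of distinct triangles $t_1,\dots,t_k$ and a sequence of distinct pseudolines $\ell_{\tau(1)},\dots,\ell_{\tau(k)}$ with $k\ge \frac{n}{3}$ such that, for each $i$, the first triple in $t_1,\dots,t_k$ that involves $\ell_{\tau(i)}$ is the triple $t_i$.
   Context: An arrangement of pseudolines is a finite collection of simple bi-infinite curves in the plane, every two meeting in exactly one crossing point, with no three through a common point (and marked by a designated unbounded cell). A triangle of $\mathcal{A}$ is a bounded cell with exactly three edges on its boundary; each triangle is identified with the triple of pseudolines bounding it, and a triple involves a pseudoline if the pseudoline is one of its three. -}

module Defs where

open import Data.Nat using (ℕ; zero; suc; _<_)
open import Data.Fin using (Fin; _≟_) renaming (_<_ to _<ᶠ_)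
open import Data.List using (List; []; _∷_; _++_; allFin)
open import Data.List.Relation.Unary.All using (All)
open import Data.Maybe using (Maybe; just; nothing)
open import Data.Product using (Σ; _×_; _,_)
open import Data.Sum using (_⊎_)
open import Data.Bool using (Bool; true; false; _∧_; _∨_; if_then_else_)
open import Relation.Nullary using (¬_)
open import Relation.Nullary.Decidable using (⌊_⌋)
open import Relation.Binary.PropositionalEquality using (_≡_; _≢_)

-- Pseudoline arrangements are represented by wiring diagrams (Goodman):
-- the pseudolines are wires 0..n-1, initially in order 0,1,...,n-1 (bottom
-- to top); a swap at position i exchanges the wires currently at positions
-- i and i+1 (a crossing).

swapAt : {A : Set} → ℕ → List A → List A
swapAt zero (x ∷ y ∷ xs) = y ∷ x ∷ xs
swapAt zero xs = xs
swapAt (suc i) [] = []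
swapAt (suc i) (x ∷ xs) = x ∷ swapAt i xs

pairAt : {A : Set} → ℕ → List A → Maybe (A × A)
pairAt zero (x ∷ y ∷ xs) = just (x , y)
pairAt zero xs = nothing
pairAt (suc i) [] = nothing
pairAt (suc i) (x ∷ xs) = pairAt i xs

crossings : {A : Set} → List A → List ℕ → List (A × A)
crossings st [] = []
crossings st (i ∷ is) with pairAt i st
... | just p = p ∷ crossings (swapAt i st) is
... | nothing = crossings st is

module _ {n : ℕ} where

  isPair : Fin n → Fin n → Fin n × Fin n → Bool
  isPair a b (x , y) = (⌊ x ≟ a ⌋ ∧ ⌊ y ≟ b ⌋) ∨ (⌊ x ≟ b ⌋ ∧ ⌊ y ≟ a ⌋)

  countPair : Fin n → Fin n → List (Fin n × Fin n) → ℕ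
  countPair a b [] = 0
  countPair a b (p ∷ ps) = if isPair a b p then suc (countPair a b ps) else countPair a b ps

  localSeq : Fin n → List (Fin n × Fin n) → List (Fin n)
  localSeq a [] = []
  localSeq a ((x , y) ∷ ps) =
    if ⌊ x ≟ a ⌋ then y ∷ localSeq a ps
    else (if ⌊ y ≟ a ⌋ then x ∷ localSeq a ps else localSeq a ps)

record Arrangement (n : ℕ) : Set where
  field
    swaps   : List ℕ
    inRange : All (λ i → suc i < n) swaps
    oncePair : (a b : Fin n) → a ≢ b → countPair a b (crossings (allFin n) swaps) ≡ 1

open Arrangement public

module _ {n : ℕ} where

  crossSeq : Arrangement n → List (Fin n × Fin n)
  crossSeq A = crossings (allFin n) (swaps A)

  loc : Arrangement n → Fin n → List (Fin n)
  loc A a = localSeq a (crossSeq A)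

  Consec : Fin n → Fin n → List (Fin n) → Set
  Consec b c xs =
    Σ (List (Fin n)) (λ ys → Σ (List (Fin n)) (λ zs →
      (xs ≡ ys ++ b ∷ c ∷ zs) ⊎ (xs ≡ ys ++ c ∷ b ∷ zs)))

Triple : ℕ → Set
Triple n = Fin n × Fin n × Fin n

-- a triangle, identified with the triple a < b < c of pseudolines bounding
-- it: a bounded cell with three edges exists iff on each of the three
-- pseudolines the crossings with the other two are consecutive.
IsTriangle : {n : ℕ} → Arrangement n → Triple n → Set
IsTriangle A (a , b , c) =
  (a <ᶠ b) × (b <ᶠ c) ×
  Consec b c (loc A a) × Consec a c (loc A b) × Consec a b (loc A c)

Involves : {n : ℕ} → Triple n → Fin n → Set
Involves (a , b , c) ℓ = (ℓ ≡ a) ⊎ (ℓ ≡ b) ⊎ (ℓ ≡ c)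

-- Every pseudoline ℓ lies on a triangle (Levi's lemma). Taking the pseudolines in turn and, whenever one is
-- not yet involved in a chosen triangle, choosing a triangle through it, produces triangles each first involving
-- its own pseudoline; as every pseudoline ends up involved and a triangle involves three, k ≥ n/3.
--
-- Levi's lemma is proved from the local sequences alone. In a wiring diagram two of three wires can only cross
-- while the third is not between them, so for a < b < c the crossings of a, b, c occur in the order ab, ac, bc
-- or in the reverse order. Hence "on m, u is crossed before v", corrected by the index order of u and v, is a
-- symmetric function of {m, u, v} (a chirotope), which yields Pasch's axiom: a line cuts an even number of sides
-- of a triangle. Now fix ℓ and one of its sides, and along a line x take the crossing with z on that side
-- nearest to ℓ. If some y crosses ℓ between x and z, it cuts the triangle ℓ x z, and the crossing on y
-- nearest to ℓ on the same side gives a pair (y, w) enclosing fewer lines on ℓ; the descent ends at an empty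
-- triangle.

module Submission where

open import Defs
open import Algebra.Solver.Ring.AlmostCommutativeRing using (fromCommutativeRing)
import Algebra.Solver.Ring.Simple as BoolSolver
open import Data.Bool using (Bool; true; false; not; _∧_; _∨_; _xor_; if_then_else_)
open import Data.Bool.Properties
  using (∨-comm; ∨-identityʳ; ∨-zeroʳ; ∨-conicalˡ; ∨-conicalʳ; ∧-zeroʳ; ∧-identityʳ; ¬-not; not-injective;
         xor-same; xor-assoc; xor-identityʳ; xor-inverseˡ; xor-annihilates-not; not-distribʳ-xor;
         xor-∧-commutativeRing)
  renaming (_≟_ to _≟ᵇ_)
open import Data.Empty using (⊥; ⊥-elim)
open import Data.Fin as F using (Fin; zero; suc) renaming (_<_ to _<ᶠ_)
open import Data.Fin.Properties
  using (<-cmp; <-asym; <-trans; <⇒≢; any?; punchInᵢ≢i; punchIn-injective; combine-injective; injective⇒≤)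
import Data.Fin.Subset as Subset
open import Data.Fin.Subset.Properties using (p⊂q⇒∣p∣<∣q∣)
open import Data.List using (List; []; _∷_; _++_; allFin; map; tabulate; mapMaybe; length; filter)
open import Data.List.Membership.Propositional using (_∈_)
open import Data.List.Membership.Propositional.Properties using (∈-filter⁺; ∈-filter⁻; ∈-allFin)
open import Data.List.Properties using (map-tabulate; length-filter)
open import Data.List.Relation.Unary.All using (All; []; _∷_)
open import Data.List.Relation.Unary.Any using (here; there)
open import Data.Maybe using (Maybe; just; nothing; maybe′; fromMaybe; _<∣>_)
open import Data.Nat using (ℕ; zero; suc; _+_; _*_; _≤_; _<_; s≤s; s≤s⁻¹; z≤n)
open import Data.Nat.Induction using (<-wellFounded)
open import Data.Nat.Properties
  using (+-suc; *-comm; suc-injective; 1+n≢0; m+n≡0⇒m≡0; n≤0⇒n≡0; n≤1+n; ≤-refl; ≤-trans)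
open import Data.Product using (Σ; Σ-syntax; ∃-syntax; _×_; _,_; proj₁; proj₂)
open import Data.Sum using (_⊎_; inj₁; inj₂)
open import Data.Vec as Vec using (Vec; []; _∷_; lookup)
open import Data.Vec.Properties using ([]=⇒lookup; lookup⇒[]=; lookup∘tabulate)
open import Function using (id; _∘_)
open import Induction.WellFounded using (Acc; acc)
open import Relation.Binary.Definitions using (DecidableEquality; tri<; tri≈; tri>)
open import Relation.Binary.PropositionalEquality
open import Relation.Nullary using (¬_; Dec; yes; no; does; ¬?)
open import Relation.Nullary.Decidable using (⌊_⌋; dec-true; dec-false; _⊎-dec_)
open import Relation.Unary using (Decidable)

markWith : Bool → Bool → Maybe Bool
markWith isV isU = if isV then just false else if isU then just true else nothing

module ListOrder {A : Set} (_≟_ : DecidableEquality A) where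

  count : A → List A → ℕ
  count u [] = 0
  count u (t ∷ ts) = if ⌊ t ≟ u ⌋ then suc (count u ts) else count u ts

  mark : A → A → A → Maybe Bool
  mark u v t = markWith ⌊ t ≟ v ⌋ ⌊ t ≟ u ⌋

  -- Which of u, v is met first: just true for u, just false for v, nothing if neither occurs.
  firstOf : A → A → List A → Maybe Bool
  firstOf u v [] = nothing
  firstOf u v (t ∷ ts) = mark u v t <∣> firstOf u v ts

  precedes : A → A → List A → Bool
  precedes u v ts = fromMaybe false (firstOf u v ts)

  count-++ : ∀ u xs ys → count u (xs ++ ys) ≡ count u xs + count u ys
  count-++ u [] ys = refl
  count-++ u (t ∷ xs) ys with t ≟ u
  ... | yes _ = cong suc (count-++ u xs ys)
  ... | no _ = count-++ u xs ys

  firstOf-++ : ∀ u v xs ys → firstOf u v (xs ++ ys) ≡ (firstOf u v xs <∣> firstOf u v ys)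
  firstOf-++ u v [] ys = refl
  firstOf-++ u v (t ∷ xs) ys with t ≟ v
  ... | yes _ = refl
  ... | no _ with t ≟ u
  ...   | yes _ = refl
  ...   | no _ = firstOf-++ u v xs ys

  firstOf-absent : ∀ u v xs → count u xs ≡ 0 → count v xs ≡ 0 → firstOf u v xs ≡ nothing
  firstOf-absent u v [] _ _ = refl
  firstOf-absent u v (t ∷ xs) cu cv with t ≟ v
  ... | yes refl = ⊥-elim (1+n≢0 cv)
  ... | no _ with t ≟ u
  ...   | yes refl = ⊥-elim (1+n≢0 cu)
  ...   | no _ = firstOf-absent u v xs cu cv

  precedes-irrefl : ∀ u xs → precedes u u xs ≡ false
  precedes-irrefl u [] = refl
  precedes-irrefl u (t ∷ xs) with t ≟ u
  ... | yes _ = refl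
  ... | no _ = precedes-irrefl u xs

  precedes-trans : ∀ u v w xs → precedes u v xs ≡ true → precedes v w xs ≡ true → precedes u w xs ≡ true
  precedes-trans u v w (t ∷ xs) uv vw with t ≟ v | t ≟ w
  precedes-trans u v w (t ∷ xs) () vw | yes _ | _
  precedes-trans u v w (t ∷ xs) uv () | no _  | yes _
  ... | no _  | no _ with t ≟ u
  ...   | yes _ = refl
  ...   | no _  = precedes-trans u v w xs uv vw

  precedes-absent : ∀ u v xs → count u xs ≡ 0 → precedes u v xs ≡ false
  precedes-absent u v [] _ = refl
  precedes-absent u v (t ∷ xs) cu with t ≟ v
  ... | yes _ = refl
  ... | no _ with t ≟ u
  ...   | yes refl = ⊥-elim (1+n≢0 cu)
  ...   | no _ = precedes-absent u v xs cu

  precedes-flip : ∀ {u v} xs → u ≢ v → count u xs ≢ 0 → precedes u v xs ≡ not (precedes v u xs)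
  precedes-flip [] u≢v cu = ⊥-elim (cu refl)
  precedes-flip {u} {v} (t ∷ xs) u≢v cu with t ≟ v | t ≟ u
  ... | yes refl | yes refl = ⊥-elim (u≢v refl)
  ... | yes _    | no _     = refl
  ... | no _     | yes _    = refl
  ... | no _     | no _     = precedes-flip xs u≢v cu

  firstOf-swap : ∀ {u v x y} m → x ≢ y → ¬ (u ≡ x × v ≡ y) → ¬ (u ≡ y × v ≡ x) →
                 firstOf u v (x ∷ y ∷ m) ≡ firstOf u v (y ∷ x ∷ m)
  firstOf-swap {u} {v} {x} {y} m x≢y ¬xy ¬yx with x ≟ v | y ≟ v | x ≟ u | y ≟ u
  ... | yes refl | yes refl | _        | _        = ⊥-elim (x≢y refl)
  ... | _        | _        | yes refl | yes refl = ⊥-elim (x≢y refl)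
  ... | yes refl | no _     | _        | yes refl = ⊥-elim (¬yx (refl , refl))
  ... | no _     | yes refl | yes refl | _        = ⊥-elim (¬xy (refl , refl))
  ... | yes _    | no _     | _        | no _     = refl
  ... | no _     | yes _    | no _     | _        = refl
  ... | no _     | no _     | yes _    | no _     = refl
  ... | no _     | no _     | no _     | yes _    = refl
  ... | no _     | no _     | no _     | no _     = refl

  count-cons-self : ∀ u xs → count u (u ∷ xs) ≡ suc (count u xs)
  count-cons-self u xs with u ≟ u
  ... | yes _ = refl
  ... | no u≢u = ⊥-elim (u≢u refl)

  count-cons-other : ∀ {u t} xs → t ≢ u → count u (t ∷ xs) ≡ count u xs
  count-cons-other {u} {t} xs t≢u with t ≟ u
  ... | yes t≡u = ⊥-elim (t≢u t≡u)
  ... | no _ = refl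

  private
    absent-before-once : ∀ u pre ys → count u (pre ++ ys) ≡ 1 → count u ys ≢ 0 → count u pre ≡ 0
    absent-before-once u pre ys once present with count u ys | count-++ u pre ys
    ... | zero  | _ = ⊥-elim (present refl)
    ... | suc k | split =
      m+n≡0⇒m≡0 (count u pre) (suc-injective (trans (sym (+-suc (count u pre) k)) (trans (sym split) once)))

  record OnceAdjacent (pre : List A) (x y : A) : Set where
    field
      x∉pre : count x pre ≡ 0
      y∉pre : count y pre ≡ 0
      x≢y   : x ≢ y

  onceAdjacent : ∀ pre x y post → count x (pre ++ x ∷ y ∷ post) ≡ 1 → count y (pre ++ x ∷ y ∷ post) ≡ 1 →
                 OnceAdjacent pre x y
  onceAdjacent pre x y post cx cy = record { x∉pre = x∉pre ; y∉pre = y∉pre ; x≢y = x≢y }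
    where
    x∉pre : count x pre ≡ 0
    x∉pre = absent-before-once x pre (x ∷ y ∷ post) cx
              (λ c → 1+n≢0 (trans (sym (count-cons-self x (y ∷ post))) c))
    y∉pre : count y pre ≡ 0
    y∉pre = absent-before-once y pre (x ∷ y ∷ post) cy y-present
      where
      y-present : count y (x ∷ y ∷ post) ≢ 0
      y-present with x ≟ y
      ... | yes _ = 1+n≢0
      ... | no _ = λ c → 1+n≢0 (trans (sym (count-cons-self y post)) c)
    x≢y : x ≢ y
    x≢y refl = 1+n≢0 (suc-injective (begin
      suc (suc (count x post))             ≡⟨ cong suc (count-cons-self x post) ⟨
      suc (count x (x ∷ post))             ≡⟨ count-cons-self x (x ∷ post) ⟨
      count x (x ∷ x ∷ post)               ≡⟨ cong (_+ count x (x ∷ x ∷ post)) x∉pre ⟨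
      count x pre + count x (x ∷ x ∷ post) ≡⟨ count-++ x pre (x ∷ x ∷ post) ⟨
      count x (pre ++ x ∷ x ∷ post)        ≡⟨ cx ⟩
      1                                    ∎))
      where open ≡-Reasoning

  firstOf-unseen : ∀ u u' v xs → count u xs ≡ 0 → count u' xs ≡ 0 → firstOf u v xs ≡ firstOf u' v xs
  firstOf-unseen u u' v [] _ _ = refl
  firstOf-unseen u u' v (t ∷ xs) cu cu' with t ≟ v
  ... | yes _ = refl
  ... | no _ with t ≟ u | t ≟ u'
  ...   | yes refl | _        = ⊥-elim (1+n≢0 cu)
  ...   | no _     | yes refl = ⊥-elim (1+n≢0 cu')
  ...   | no _     | no _     = firstOf-unseen u u' v xs cu cu'

  firstOf-skip : ∀ {u v} pre ys → count u pre ≡ 0 → count v pre ≡ 0 → firstOf u v (pre ++ ys) ≡ firstOf u v ys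
  firstOf-skip {u} {v} pre ys cu cv rewrite firstOf-++ u v pre ys | firstOf-absent u v pre cu cv = refl

  precedes-swap-other : ∀ {u v x y} pre post → x ≢ y → ¬ (u ≡ x × v ≡ y) → ¬ (u ≡ y × v ≡ x) →
                        precedes u v (pre ++ y ∷ x ∷ post) ≡ precedes u v (pre ++ x ∷ y ∷ post)
  precedes-swap-other {u} {v} {x} {y} pre post x≢y ¬xy ¬yx
    rewrite firstOf-++ u v pre (y ∷ x ∷ post) | firstOf-++ u v pre (x ∷ y ∷ post) with firstOf u v pre
  ... | just _  = refl
  ... | nothing = cong (fromMaybe false) (sym (firstOf-swap post x≢y ¬xy ¬yx))

  precedes-head : ∀ {x y} post → x ≢ y →
                  precedes x y (x ∷ y ∷ post) ≡ true × precedes x y (y ∷ x ∷ post) ≡ false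
  precedes-head {x} {y} post x≢y with x ≟ y | x ≟ x | y ≟ y
  ... | no _    | yes _  | yes _  = refl , refl
  ... | yes x≡y | _      | _      = ⊥-elim (x≢y x≡y)
  ... | _       | no x≢x | _      = ⊥-elim (x≢x refl)
  ... | _       | _      | no y≢y = ⊥-elim (y≢y refl)

  module _ {pre x y} (adj : OnceAdjacent pre x y) (post : List A) where
    open OnceAdjacent adj

    precedes-swap-pair : ∀ {u v} → (u ≡ x × v ≡ y) ⊎ (u ≡ y × v ≡ x) →
                         precedes u v (pre ++ y ∷ x ∷ post) ≡ not (precedes u v (pre ++ x ∷ y ∷ post))
    precedes-swap-pair (inj₁ (refl , refl))
      rewrite firstOf-skip pre (y ∷ x ∷ post) x∉pre y∉pre | firstOf-skip pre (x ∷ y ∷ post) x∉pre y∉pre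
            | proj₁ (precedes-head post x≢y) | proj₂ (precedes-head post x≢y) = refl
    precedes-swap-pair (inj₂ (refl , refl))
      rewrite firstOf-skip pre (y ∷ x ∷ post) y∉pre x∉pre | firstOf-skip pre (x ∷ y ∷ post) y∉pre x∉pre
            | proj₁ (precedes-head post (≢-sym x≢y)) | proj₂ (precedes-head post (≢-sym x≢y)) = refl

    precedes-adjacent : ∀ {w} → w ≢ x → w ≢ y →
                        precedes x w (pre ++ x ∷ y ∷ post) ≡ precedes y w (pre ++ x ∷ y ∷ post)
    precedes-adjacent {w} w≢x w≢y
      rewrite firstOf-++ x w pre (x ∷ y ∷ post) | firstOf-++ y w pre (x ∷ y ∷ post)
            | firstOf-unseen x y w pre x∉pre y∉pre
      with firstOf y w pre | x ≟ w | x ≟ x | x ≟ y | y ≟ w | y ≟ y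
    ... | just _  | _        | _      | _        | _        | _      = refl
    ... | nothing | no _     | yes _  | no _     | no _     | yes _  = refl
    ... | nothing | yes refl | _      | _        | _        | _      = ⊥-elim (w≢x refl)
    ... | nothing | _        | no x≢x | _        | _        | _      = ⊥-elim (x≢x refl)
    ... | nothing | _        | _      | yes x≡y  | _        | _      = ⊥-elim (x≢y x≡y)
    ... | nothing | _        | _      | _        | yes refl | _      = ⊥-elim (w≢y refl)
    ... | nothing | _        | _      | _        | _        | no y≢y = ⊥-elim (y≢y refl)

  count-swap : ∀ u pre x y post → count u (pre ++ y ∷ x ∷ post) ≡ count u (pre ++ x ∷ y ∷ post)
  count-swap u pre x y post rewrite count-++ u pre (y ∷ x ∷ post) | count-++ u pre (x ∷ y ∷ post)
    with x ≟ u | y ≟ u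
  ... | yes _ | yes _ = refl
  ... | yes _ | no _  = refl
  ... | no _  | yes _ = refl
  ... | no _  | no _  = refl

  strictlyBetween : A → A → A → List A → Bool
  strictlyBetween u v w xs = (precedes u w xs ∧ precedes w v xs) ∨ (precedes v w xs ∧ precedes w u xs)

  private
    precedes-skip : ∀ {u v h} xs → h ≢ u → h ≢ v → precedes u v (h ∷ xs) ≡ precedes u v xs
    precedes-skip {u} {v} {h} xs h≢u h≢v with h ≟ v | h ≟ u
    ... | yes h≡v | _ = ⊥-elim (h≢v h≡v)
    ... | _ | yes h≡u = ⊥-elim (h≢u h≡u)
    ... | no _ | no _ = refl

    once-tail : ∀ {u} t → count u (u ∷ t) ≤ 1 → count u t ≡ 0
    once-tail {u} t le = n≤0⇒n≡0 (s≤s⁻¹ (subst (_≤ 1) (count-cons-self u t) le))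

    occurs-after : ∀ {p q} t → p ≢ q → count q (p ∷ t) ≡ 1 → count q t ≢ 0
    occurs-after t p≢q cq c = 1+n≢0 (trans (sym cq) (trans (count-cons-other t p≢q) c))

    count-tail-≤ : ∀ u h t → count u t ≤ count u (h ∷ t)
    count-tail-≤ u h t with h ≟ u
    ... | yes _ = n≤1+n (count u t)
    ... | no _ = ≤-refl

    next-is : ∀ {p q} t → p ≢ q → count p t ≡ 0 → count q t ≢ 0 →
              (∀ w → precedes p w (p ∷ t) ∧ precedes w q (p ∷ t) ≡ false) → Σ[ zs ∈ List A ] t ≡ q ∷ zs
    next-is [] p≢q _ q∈t _ = ⊥-elim (q∈t refl)
    next-is {p} {q} (h ∷ t) p≢q p∉t q∈t nothing-between with h ≟ q
    ... | yes refl = t , refl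
    ... | no h≢q with p ≟ h | p ≟ q | p ≟ p | h ≟ h | nothing-between h
    ...   | yes refl | _ | _ | _ | _ = ⊥-elim (1+n≢0 (trans (sym (count-cons-self p t)) p∉t))
    ...   | no _ | yes p≡q | _ | _ | _ = ⊥-elim (p≢q p≡q)
    ...   | no _ | no _ | no p≢p | _ | _ = ⊥-elim (p≢p refl)
    ...   | no _ | no _ | yes _ | no h≢h | _ = ⊥-elim (h≢h refl)
    ...   | no _ | no _ | yes _ | yes _ | ()

  Adjacent : A → A → List A → Set
  Adjacent p q xs = Σ[ ys ∈ List A ] Σ[ zs ∈ List A ] ((xs ≡ ys ++ p ∷ q ∷ zs) ⊎ (xs ≡ ys ++ q ∷ p ∷ zs))

  adjacent-sym : ∀ {p q xs} → Adjacent p q xs → Adjacent q p xs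
  adjacent-sym (ys , zs , inj₁ eq) = ys , zs , inj₂ eq
  adjacent-sym (ys , zs , inj₂ eq) = ys , zs , inj₁ eq

  adjacent-if-nothing-between : ∀ {p q} xs → p ≢ q → count p xs ≡ 1 → count q xs ≡ 1 → (∀ u → count u xs ≤ 1) →
    (∀ w → strictlyBetween p q w xs ≡ false) → Adjacent p q xs
  adjacent-if-nothing-between [] p≢q () cq once none
  adjacent-if-nothing-between {p} {q} (h ∷ t) p≢q cp cq once none = by-cases h (h ≟ p) (h ≟ q) cp cq once none
    where
    by-cases : ∀ h → Dec (h ≡ p) → Dec (h ≡ q) → count p (h ∷ t) ≡ 1 → count q (h ∷ t) ≡ 1 →
               (∀ u → count u (h ∷ t) ≤ 1) → (∀ w → strictlyBetween p q w (h ∷ t) ≡ false) → Adjacent p q (h ∷ t)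
    by-cases h (yes refl) _ cp cq once none
      with next-is t p≢q (once-tail t (once h)) (occurs-after t p≢q cq) (λ w → ∨-conicalˡ _ _ (none w))
    ... | zs , refl = [] , zs , inj₁ refl
    by-cases h (no _) (yes refl) cp cq once none
      with next-is t (≢-sym p≢q) (once-tail t (once h)) (occurs-after t (≢-sym p≢q) cp)
                   (λ w → ∨-conicalʳ _ _ (none w))
    ... | zs , refl = [] , zs , inj₂ refl
    by-cases h (no h≢p) (no h≢q) cp cq once none
      with adjacent-if-nothing-between t p≢q
             (trans (sym (count-cons-other t h≢p)) cp) (trans (sym (count-cons-other t h≢q)) cq)
             (λ u → ≤-trans (count-tail-≤ u h t) (once u)) none-in-t
      where
      none-in-t : ∀ w → strictlyBetween p q w t ≡ false
      none-in-t w with w ≟ h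
      ... | yes refl
        rewrite precedes-absent w q t (once-tail t (once w)) | precedes-absent w p t (once-tail t (once w)) =
        cong₂ _∨_ (∧-zeroʳ (precedes p w t)) (∧-zeroʳ (precedes q w t))
      ... | no w≢h
        rewrite sym (precedes-skip {p} {w} t h≢p (≢-sym w≢h)) | sym (precedes-skip {w} {q} t (≢-sym w≢h) h≢q)
              | sym (precedes-skip {q} {w} t h≢q (≢-sym w≢h)) | sym (precedes-skip {w} {p} t (≢-sym w≢h) h≢p) = none w
    ... | ys , zs , inj₁ refl = h ∷ ys , zs , inj₁ refl
    ... | ys , zs , inj₂ refl = h ∷ ys , zs , inj₂ refl

-- Wiring diagrams

swap-decomposition : ∀ {A : Set} i (st : List A) {x y} → pairAt i st ≡ just (x , y) →
  Σ[ pre ∈ List A ] Σ[ post ∈ List A ] st ≡ pre ++ x ∷ y ∷ post × swapAt i st ≡ pre ++ y ∷ x ∷ post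
swap-decomposition zero (a ∷ b ∷ st) refl = [] , st , refl , refl
swap-decomposition (suc i) (a ∷ st) eq with swap-decomposition i st eq
... | pre , post , st≡ , swap≡ = a ∷ pre , post , cong (a ∷_) st≡ , cong (a ∷_) swap≡

module _ {n : ℕ} where
  open ListOrder (F._≟_ {n}) public

EachOnce : {n : ℕ} → List (Fin n) → Set
EachOnce {n} st = (u : Fin n) → count u st ≡ 1

-- Q st cs: a property of the current order st of the wires and of the crossings cs still to come.
crossings-elim : ∀ {n} (Q : List (Fin n) → List (Fin n × Fin n) → Set) →
  (∀ {st} → Q st []) →
  (∀ {pre x y post cs} → EachOnce (pre ++ x ∷ y ∷ post) →
     Q (pre ++ y ∷ x ∷ post) cs → Q (pre ++ x ∷ y ∷ post) ((x , y) ∷ cs)) →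
  ∀ is st → EachOnce st → Q st (crossings st is)
crossings-elim Q done step [] st once = done
crossings-elim Q done step (i ∷ is) st once with pairAt i st in eq
... | nothing = crossings-elim Q done step is st once
... | just (x , y) with swap-decomposition i st eq
...   | pre , post , refl , swap≡ rewrite swap≡ =
  step once (crossings-elim Q done step is (pre ++ y ∷ x ∷ post) (λ u → trans (count-swap u pre x y post) (once u)))

private
  allFin-tail : ∀ n → map F.suc (allFin n) ≡ tabulate F.suc
  allFin-tail n = map-tabulate id F.suc

  count-map-suc : ∀ {n} (u : Fin n) xs → count (F.suc u) (map F.suc xs) ≡ count u xs
  count-map-suc u [] = refl
  count-map-suc u (t ∷ xs) with t F.≟ u
  ... | yes _ = cong suc (count-map-suc u xs)
  ... | no _ = count-map-suc u xs

  count-zero-map-suc : ∀ {n} (xs : List (Fin n)) → count F.zero (map F.suc xs) ≡ 0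
  count-zero-map-suc [] = refl
  count-zero-map-suc (t ∷ xs) = count-zero-map-suc xs

  firstOf-map-suc : ∀ {n} (u v : Fin n) xs → firstOf (F.suc u) (F.suc v) (map F.suc xs) ≡ firstOf u v xs
  firstOf-map-suc u v [] = refl
  firstOf-map-suc u v (t ∷ xs) with t F.≟ v
  ... | yes _ = refl
  ... | no _ with t F.≟ u
  ...   | yes _ = refl
  ...   | no _ = firstOf-map-suc u v xs

allFin-eachOnce : ∀ n → EachOnce (allFin n)
allFin-eachOnce (suc n) F.zero rewrite sym (allFin-tail n) = cong suc (count-zero-map-suc (allFin n))
allFin-eachOnce (suc n) (F.suc u) rewrite sym (allFin-tail n) =
  trans (count-map-suc u (allFin n)) (allFin-eachOnce n u)

precedes-allFin : ∀ {n} {u v : Fin n} → u F.< v → precedes u v (allFin n) ≡ true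
precedes-allFin {suc n} {F.zero} {F.suc v} _ = refl
precedes-allFin {suc n} {F.suc u} {F.suc v} (s≤s u<v) rewrite sym (allFin-tail n) =
  trans (cong (fromMaybe false) (firstOf-map-suc u v (allFin n))) (precedes-allFin u<v)

Proper : {n : ℕ} → Fin n × Fin n → Set
Proper (x , y) = x ≢ y

crossings-proper : ∀ {n} is (st : List (Fin n)) → EachOnce st → All Proper (crossings st is)
crossings-proper = crossings-elim (λ _ cs → All Proper cs) []
  (λ {pre} {x} {y} {post} once rest → OnceAdjacent.x≢y (onceAdjacent pre x y post (once x) (once y)) ∷ rest)

count-localSeq : ∀ {n} {a b : Fin n} cs → a ≢ b → count b (localSeq a cs) ≡ countPair a b cs
count-localSeq [] a≢b = refl
count-localSeq {a = a} {b} ((x , y) ∷ cs) a≢b with x F.≟ a | y F.≟ a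
... | yes refl | _ with y F.≟ b | x F.≟ b
...   | yes refl | _        = cong suc (count-localSeq cs a≢b)
...   | no _     | yes refl = ⊥-elim (a≢b refl)
...   | no _     | no _     = count-localSeq cs a≢b
count-localSeq {a = a} {b} ((x , y) ∷ cs) a≢b | no _ | yes refl with x F.≟ b | y F.≟ b
...   | yes refl | _        = cong suc (count-localSeq cs a≢b)
...   | no _     | yes refl = ⊥-elim (a≢b refl)
...   | no _     | no _     = count-localSeq cs a≢b
count-localSeq {a = a} {b} ((x , y) ∷ cs) a≢b | no _ | no _ with x F.≟ b | y F.≟ b
...   | yes _ | yes _ = count-localSeq cs a≢b
...   | yes _ | no _  = count-localSeq cs a≢b
...   | no _  | yes _ = count-localSeq cs a≢b
...   | no _  | no _  = count-localSeq cs a≢b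

count-localSeq-self : ∀ {n} (a : Fin n) cs → All Proper cs → count a (localSeq a cs) ≡ 0
count-localSeq-self a [] [] = refl
count-localSeq-self a ((x , y) ∷ cs) (x≢y ∷ proper) with x F.≟ a | y F.≟ a
... | yes refl | yes refl = ⊥-elim (x≢y refl)
... | yes refl | no y≢a   = trans (count-cons-other (localSeq a cs) y≢a) (count-localSeq-self a cs proper)
... | no x≢a   | yes refl = trans (count-cons-other (localSeq a cs) x≢a) (count-localSeq-self a cs proper)
... | no _     | no _     = count-localSeq-self a cs proper

module _ {n : ℕ} {u v x y : Fin n} where

  isPair-sound : isPair u v (x , y) ≡ true → (u ≡ x × v ≡ y) ⊎ (u ≡ y × v ≡ x)
  isPair-sound eq with x F.≟ u | y F.≟ v | x F.≟ v | y F.≟ u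
  ... | yes refl | yes refl | _        | _        = inj₁ (refl , refl)
  ... | _        | _        | yes refl | yes refl = inj₂ (refl , refl)
  isPair-sound () | yes _ | no _  | yes _ | no _
  isPair-sound () | yes _ | no _  | no _  | _
  isPair-sound () | no _  | _     | yes _ | no _
  isPair-sound () | no _  | _     | no _  | _

  isPair-complete : (u ≡ x × v ≡ y) ⊎ (u ≡ y × v ≡ x) → isPair u v (x , y) ≡ true
  isPair-complete (inj₁ (refl , refl)) with x F.≟ x | y F.≟ y
  ... | yes _ | yes _ = refl
  ... | no x≢x | _ = ⊥-elim (x≢x refl)
  ... | _ | no y≢y = ⊥-elim (y≢y refl)
  isPair-complete (inj₂ (refl , refl)) with x F.≟ y | y F.≟ x | x F.≟ x | y F.≟ y
  ... | yes _ | yes _ | _ | _ = refl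
  ... | no _  | _     | yes _ | yes _ = refl
  ... | yes _ | no _  | yes _ | yes _ = refl
  ... | _     | _     | no x≢x | _ = ⊥-elim (x≢x refl)
  ... | _     | _     | _ | no y≢y = ⊥-elim (y≢y refl)

isPair-sym : ∀ {n} {u v : Fin n} p → isPair u v p ≡ isPair v u p
isPair-sym {u = u} {v} (x , y) = ∨-comm (⌊ x F.≟ u ⌋ ∧ ⌊ y F.≟ v ⌋) (⌊ x F.≟ v ⌋ ∧ ⌊ y F.≟ u ⌋)

module _ {n : ℕ} {pre : List (Fin n)} {x y : Fin n} (adj : OnceAdjacent pre x y) (post : List (Fin n)) where
  open OnceAdjacent adj

  precedes-after-swap : ∀ u v →
    precedes u v (pre ++ y ∷ x ∷ post) ≡ isPair u v (x , y) xor precedes u v (pre ++ x ∷ y ∷ post)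
  precedes-after-swap u v with isPair u v (x , y) in eq
  ... | true  = precedes-swap-pair adj post (isPair-sound eq)
  ... | false = precedes-swap-other pre post x≢y (λ h → not-pair (inj₁ h)) (λ h → not-pair (inj₂ h))
    where
    not-pair : ¬ ((u ≡ x × v ≡ y) ⊎ (u ≡ y × v ≡ x))
    not-pair h with trans (sym (isPair-complete h)) eq
    ... | ()

  precedes-crossing : ∀ {u v w} → isPair u v (x , y) ≡ true → w ≢ u → w ≢ v →
                      precedes u w (pre ++ x ∷ y ∷ post) ≡ precedes v w (pre ++ x ∷ y ∷ post)
  precedes-crossing {u} {v} uv w≢u w≢v with isPair-sound {u = u} {v} {x} {y} uv
  ... | inj₁ (refl , refl) = precedes-adjacent adj post w≢u w≢v
  ... | inj₂ (refl , refl) = sym (precedes-adjacent adj post w≢v w≢u)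

module _ {n : ℕ} {m w : Fin n} (m≢w : m ≢ w) where

  isPair-left : ∀ y → isPair m w (m , y) ≡ ⌊ y F.≟ w ⌋
  isPair-left y with m F.≟ m | m F.≟ w
  ... | yes _ | no _ = ∨-identityʳ _
  ... | no m≢m | _ = ⊥-elim (m≢m refl)
  ... | _ | yes m≡w = ⊥-elim (m≢w m≡w)

  isPair-right : ∀ x → isPair m w (x , m) ≡ ⌊ x F.≟ w ⌋
  isPair-right x with m F.≟ m | m F.≟ w
  ... | yes _ | no _ rewrite ∧-zeroʳ ⌊ x F.≟ m ⌋ = ∧-identityʳ _
  ... | no m≢m | _ = ⊥-elim (m≢m refl)
  ... | _ | yes m≡w = ⊥-elim (m≢w m≡w)

isPair-elsewhere : ∀ {n} {m w x y : Fin n} → x ≢ m → y ≢ m → isPair m w (x , y) ≡ false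
isPair-elsewhere {m = m} {w} {x} {y} x≢m y≢m with x F.≟ m | y F.≟ m
... | yes x≡m | _ = ⊥-elim (x≢m x≡m)
... | _ | yes y≡m = ⊥-elim (y≢m y≡m)
... | no _ | no _ = ∧-zeroʳ ⌊ x F.≟ w ⌋

module _ {n : ℕ} {m : Fin n} where

  localSeq-left : ∀ y ps → localSeq m ((m , y) ∷ ps) ≡ y ∷ localSeq m ps
  localSeq-left y ps with m F.≟ m
  ... | yes _ = refl
  ... | no m≢m = ⊥-elim (m≢m refl)

  localSeq-right : ∀ {x} ps → x ≢ m → localSeq m ((x , m) ∷ ps) ≡ x ∷ localSeq m ps
  localSeq-right {x} ps x≢m with x F.≟ m | m F.≟ m
  ... | yes x≡m | _ = ⊥-elim (x≢m x≡m)
  ... | no _ | yes _ = refl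
  ... | no _ | no m≢m = ⊥-elim (m≢m refl)

  localSeq-away : ∀ {x y} ps → x ≢ m → y ≢ m → localSeq m ((x , y) ∷ ps) ≡ localSeq m ps
  localSeq-away {x} {y} ps x≢m y≢m with x F.≟ m | y F.≟ m
  ... | yes x≡m | _ = ⊥-elim (x≢m x≡m)
  ... | _ | yes y≡m = ⊥-elim (y≢m y≡m)
  ... | no _ | no _ = refl

pairMark : ∀ {n} → Fin n → Fin n → Fin n → Fin n × Fin n → Maybe Bool
pairMark m u v p = markWith (isPair m v p) (isPair m u p)

module _ {n : ℕ} {m u v : Fin n} (m≢u : m ≢ u) (m≢v : m ≢ v) where

  firstOf-localSeq : ∀ p ps →
    firstOf u v (localSeq m (p ∷ ps)) ≡ (pairMark m u v p <∣> firstOf u v (localSeq m ps))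
  firstOf-localSeq (x , y) ps = by-cases x y (x F.≟ m) (y F.≟ m)
    where
    by-cases : ∀ x y → Dec (x ≡ m) → Dec (y ≡ m) →
               firstOf u v (localSeq m ((x , y) ∷ ps)) ≡ (pairMark m u v (x , y) <∣> firstOf u v (localSeq m ps))
    by-cases x y (yes refl) _ = trans (cong (firstOf u v) (localSeq-left y ps))
      (cong (_<∣> firstOf u v (localSeq m ps)) (sym (cong₂ markWith (isPair-left m≢v y) (isPair-left m≢u y))))
    by-cases x y (no x≢m) (yes refl) = trans (cong (firstOf u v) (localSeq-right ps x≢m))
      (cong (_<∣> firstOf u v (localSeq m ps)) (sym (cong₂ markWith (isPair-right m≢v x) (isPair-right m≢u x))))
    by-cases x y (no x≢m) (no y≢m) = trans (cong (firstOf u v) (localSeq-away ps x≢m y≢m))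
      (cong (_<∣> firstOf u v (localSeq m ps))
            (sym (cong₂ markWith (isPair-elsewhere x≢m y≢m) (isPair-elsewhere x≢m y≢m))))

-- Three wires

data TriplePair : Set where
  ab ac bc : TriplePair

_≟ᵖ_ : DecidableEquality TriplePair
ab ≟ᵖ ab = yes refl
ac ≟ᵖ ac = yes refl
bc ≟ᵖ bc = yes refl
ab ≟ᵖ ac = no λ ()
ab ≟ᵖ bc = no λ ()
ac ≟ᵖ ab = no λ ()
ac ≟ᵖ bc = no λ ()
bc ≟ᵖ ab = no λ ()
bc ≟ᵖ ac = no λ ()

module Pairs = ListOrder _≟ᵖ_

-- Whether a precedes b, a precedes c, b precedes c in the current order of the wires.
Order3 : Set
Order3 = Bool × Bool × Bool

toggle : TriplePair → Order3 → Order3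
toggle ab (p , q , r) = not p , q , r
toggle ac (p , q , r) = p , not q , r
toggle bc (p , q , r) = p , q , not r

-- Two of the three wires can only cross when the third is not between them.
adjacentIn : TriplePair → Order3 → Bool
adjacentIn ab (p , q , r) = not (q xor r)
adjacentIn ac (p , q , r) = p xor r
adjacentIn bc (p , q , r) = not (p xor q)

feasible : Order3 → List TriplePair → Bool
feasible o [] = true
feasible o (e ∷ es) = adjacentIn e o ∧ feasible (toggle e o) es

feasible-once : ∀ es → feasible (true , true , true) es ≡ true →
  Pairs.count ab es ≡ 1 → Pairs.count ac es ≡ 1 → Pairs.count bc es ≡ 1 →
  es ≡ ab ∷ ac ∷ bc ∷ [] ⊎ es ≡ bc ∷ ac ∷ ab ∷ []
feasible-once (ab ∷ ac ∷ bc ∷ []) _ _ _ _ = inj₁ refl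
feasible-once (bc ∷ ac ∷ ab ∷ []) _ _ _ _ = inj₂ refl
feasible-once [] _ () _ _
feasible-once (ac ∷ es) () _ _ _
feasible-once (ab ∷ []) _ _ () _
feasible-once (ab ∷ ab ∷ es) _ () _ _
feasible-once (ab ∷ bc ∷ es) () _ _ _
feasible-once (ab ∷ ac ∷ []) _ _ _ ()
feasible-once (ab ∷ ac ∷ ab ∷ es) _ () _ _
feasible-once (ab ∷ ac ∷ ac ∷ es) _ _ () _
feasible-once (ab ∷ ac ∷ bc ∷ ab ∷ es) _ () _ _
feasible-once (ab ∷ ac ∷ bc ∷ ac ∷ es) _ _ () _
feasible-once (ab ∷ ac ∷ bc ∷ bc ∷ es) _ _ _ ()
feasible-once (bc ∷ []) _ () _ _
feasible-once (bc ∷ ab ∷ es) () _ _ _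
feasible-once (bc ∷ bc ∷ es) _ _ _ ()
feasible-once (bc ∷ ac ∷ []) _ () _ _
feasible-once (bc ∷ ac ∷ ac ∷ es) _ _ () _
feasible-once (bc ∷ ac ∷ bc ∷ es) _ _ _ ()
feasible-once (bc ∷ ac ∷ ab ∷ ab ∷ es) _ () _ _
feasible-once (bc ∷ ac ∷ ab ∷ ac ∷ es) _ _ () _
feasible-once (bc ∷ ac ∷ ab ∷ bc ∷ es) _ _ _ ()

event-orders-agree : ∀ {es} → es ≡ ab ∷ ac ∷ bc ∷ [] ⊎ es ≡ bc ∷ ac ∷ ab ∷ [] →
  Pairs.precedes ab bc es ≡ Pairs.precedes ab ac es × Pairs.precedes ac bc es ≡ Pairs.precedes ab ac es
event-orders-agree (inj₁ refl) = refl , refl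
event-orders-agree (inj₂ refl) = refl , refl

module ThreeWires {n : ℕ} {a b c : Fin n} (a≢b : a ≢ b) (a≢c : a ≢ c) (b≢c : b ≢ c) where

  pairOf : Fin n × Fin n → Maybe TriplePair
  pairOf p =
    if isPair a b p then just ab else if isPair a c p then just ac else if isPair b c p then just bc else nothing

  events : List (Fin n × Fin n) → List TriplePair
  events = mapMaybe pairOf

  order : List (Fin n) → Order3
  order st = precedes a b st , precedes a c st , precedes b c st

  private
    share-first : ∀ {u v w : Fin n} p → isPair u v p ≡ true → isPair u w p ≡ true → v ≡ w
    share-first {u} {v} {w} (x , y) uv uw
      with isPair-sound {u = u} {v} {x} {y} uv | isPair-sound {u = u} {w} {x} {y} uw
    ... | inj₁ (refl , refl) | inj₁ (_ , refl)    = refl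
    ... | inj₁ (refl , refl) | inj₂ (refl , refl) = refl
    ... | inj₂ (refl , refl) | inj₁ (refl , refl) = refl
    ... | inj₂ (refl , refl) | inj₂ (_ , refl)    = refl

    exclusive : ∀ {u v w : Fin n} p → v ≢ w → isPair u v p ≡ true → isPair u w p ≡ false
    exclusive {u} {v} {w} p v≢w uv with isPair u w p in uw
    ... | false = refl
    ... | true  = ⊥-elim (v≢w (share-first p uv uw))

  data PairView (p : Fin n × Fin n) : Maybe TriplePair → Set where
    crosses-ab : isPair a b p ≡ true → isPair a c p ≡ false → isPair b c p ≡ false → PairView p (just ab)
    crosses-ac : isPair a b p ≡ false → isPair a c p ≡ true → isPair b c p ≡ false → PairView p (just ac)
    crosses-bc : isPair a b p ≡ false → isPair a c p ≡ false → isPair b c p ≡ true → PairView p (just bc)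
    elsewhere  : isPair a b p ≡ false → isPair a c p ≡ false → isPair b c p ≡ false → PairView p nothing

  pairView : ∀ p → PairView p (pairOf p)
  pairView p with isPair a b p in eab | isPair a c p in eac | isPair b c p in ebc
  ... | true  | _     | _     = crosses-ab eab (exclusive p b≢c eab) (exclusive p a≢c (trans (isPair-sym p) eab))
  ... | false | true  | _     = crosses-ac eab eac (trans (isPair-sym p) (exclusive p a≢b (trans (isPair-sym p) eac)))
  ... | false | false | true  = crosses-bc eab eac ebc
  ... | false | false | false = elsewhere eab eac ebc

  module _ {pre post : List (Fin n)} {x y : Fin n} (once : EachOnce (pre ++ x ∷ y ∷ post)) where
    private
      S  = pre ++ x ∷ y ∷ post
      S′ = pre ++ y ∷ x ∷ post
      adj = onceAdjacent pre x y post (once x) (once y)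
      present : ∀ u → count u S ≢ 0
      present u c = 1+n≢0 (trans (sym (once u)) c)

    order-after-swap : order S′ ≡ maybe′ toggle id (pairOf (x , y)) (order S)
    order-after-swap
      rewrite precedes-after-swap adj post a b | precedes-after-swap adj post a c | precedes-after-swap adj post b c
      with pairOf (x , y) | pairView (x , y)
    ... | _ | crosses-ab eab eac ebc rewrite eab | eac | ebc = refl
    ... | _ | crosses-ac eab eac ebc rewrite eab | eac | ebc = refl
    ... | _ | crosses-bc eab eac ebc rewrite eab | eac | ebc = refl
    ... | _ | elsewhere  eab eac ebc rewrite eab | eac | ebc = refl

    crossing-adjacent : ∀ {e} → pairOf (x , y) ≡ just e → adjacentIn e (order S) ≡ true
    crossing-adjacent eq with pairOf (x , y) | pairView (x , y)
    crossing-adjacent refl | _ | crosses-ab eab _ _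
      rewrite precedes-crossing adj post eab (≢-sym a≢c) (≢-sym b≢c) = cong not (xor-same (precedes b c S))
    crossing-adjacent refl | _ | crosses-ac _ eac _
      rewrite precedes-crossing adj post eac (≢-sym a≢b) b≢c | precedes-flip S (≢-sym b≢c) (present c) =
      xor-inverseˡ (precedes b c S)
    crossing-adjacent refl | _ | crosses-bc _ _ ebc
      rewrite precedes-flip S a≢b (present a) | precedes-flip S a≢c (present a)
            | precedes-crossing adj post ebc a≢b a≢c = cong not (xor-same (not (precedes c a S)))

    feasible-step : ∀ es → feasible (order S′) es ≡ true →
                    feasible (order S) (maybe′ _∷_ id (pairOf (x , y)) es) ≡ true
    feasible-step es h rewrite order-after-swap with pairOf (x , y) in eq
    ... | nothing = h
    ... | just e rewrite crossing-adjacent eq = h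

  ends : TriplePair → Fin n × Fin n
  ends ab = a , b
  ends ac = a , c
  ends bc = b , c

  ends-distinct : ∀ e → proj₁ (ends e) ≢ proj₂ (ends e)
  ends-distinct ab = a≢b
  ends-distinct ac = a≢c
  ends-distinct bc = b≢c

  count-events : ∀ e cs → Pairs.count e (events cs) ≡ countPair (proj₁ (ends e)) (proj₂ (ends e)) cs
  count-events e [] = refl
  count-events e (p ∷ cs) with pairOf p | pairView p | e
  ... | _ | crosses-ab h _ _ | ab rewrite h = cong suc (count-events ab cs)
  ... | _ | crosses-ab _ h _ | ac rewrite h = count-events ac cs
  ... | _ | crosses-ab _ _ h | bc rewrite h = count-events bc cs
  ... | _ | crosses-ac h _ _ | ab rewrite h = count-events ab cs
  ... | _ | crosses-ac _ h _ | ac rewrite h = cong suc (count-events ac cs)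
  ... | _ | crosses-ac _ _ h | bc rewrite h = count-events bc cs
  ... | _ | crosses-bc h _ _ | ab rewrite h = count-events ab cs
  ... | _ | crosses-bc _ h _ | ac rewrite h = count-events ac cs
  ... | _ | crosses-bc _ _ h | bc rewrite h = cong suc (count-events bc cs)
  ... | _ | elsewhere h _ _  | ab rewrite h = count-events ab cs
  ... | _ | elsewhere _ h _  | ac rewrite h = count-events ac cs
  ... | _ | elsewhere _ _ h  | bc rewrite h = count-events bc cs

  eventMark : TriplePair → TriplePair → Fin n × Fin n → Maybe Bool
  eventMark e₁ e₂ p = maybe′ (Pairs.mark e₁ e₂) nothing (pairOf p)

  private
    firstOf-events : ∀ e₁ e₂ p cs →
      Pairs.firstOf e₁ e₂ (events (p ∷ cs)) ≡ (eventMark e₁ e₂ p <∣> Pairs.firstOf e₁ e₂ (events cs))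
    firstOf-events e₁ e₂ p cs with pairOf p
    ... | just _  = refl
    ... | nothing = refl

    lockstep : ∀ {m u v e₁ e₂} → m ≢ u → m ≢ v → (∀ p → pairMark m u v p ≡ eventMark e₁ e₂ p) →
               ∀ cs → firstOf u v (localSeq m cs) ≡ Pairs.firstOf e₁ e₂ (events cs)
    lockstep m≢u m≢v same [] = refl
    lockstep {m} {u} {v} {e₁} {e₂} m≢u m≢v same (p ∷ cs) =
      trans (firstOf-localSeq m≢u m≢v p cs)
            (trans (cong₂ _<∣>_ (same p) (lockstep m≢u m≢v same cs)) (sym (firstOf-events e₁ e₂ p cs)))

    marks-a : ∀ p → pairMark a b c p ≡ eventMark ab ac p
    marks-a p with pairOf p | pairView p
    ... | _ | crosses-ab h₁ h₂ _ rewrite h₁ | h₂ = refl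
    ... | _ | crosses-ac h₁ h₂ _ rewrite h₁ | h₂ = refl
    ... | _ | crosses-bc h₁ h₂ _ rewrite h₁ | h₂ = refl
    ... | _ | elsewhere  h₁ h₂ _ rewrite h₁ | h₂ = refl

    marks-b : ∀ p → pairMark b a c p ≡ eventMark ab bc p
    marks-b p rewrite isPair-sym {u = b} {a} p with pairOf p | pairView p
    ... | _ | crosses-ab h₁ _ h₃ rewrite h₁ | h₃ = refl
    ... | _ | crosses-ac h₁ _ h₃ rewrite h₁ | h₃ = refl
    ... | _ | crosses-bc h₁ _ h₃ rewrite h₁ | h₃ = refl
    ... | _ | elsewhere  h₁ _ h₃ rewrite h₁ | h₃ = refl

    marks-c : ∀ p → pairMark c a b p ≡ eventMark ac bc p
    marks-c p rewrite isPair-sym {u = c} {a} p | isPair-sym {u = c} {b} p with pairOf p | pairView p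
    ... | _ | crosses-ab _ h₂ h₃ rewrite h₂ | h₃ = refl
    ... | _ | crosses-ac _ h₂ h₃ rewrite h₂ | h₃ = refl
    ... | _ | crosses-bc _ h₂ h₃ rewrite h₂ | h₃ = refl
    ... | _ | elsewhere  _ h₂ h₃ rewrite h₂ | h₃ = refl

  local-orders : ∀ cs →
    precedes b c (localSeq a cs) ≡ Pairs.precedes ab ac (events cs) ×
    precedes a c (localSeq b cs) ≡ Pairs.precedes ab bc (events cs) ×
    precedes a b (localSeq c cs) ≡ Pairs.precedes ac bc (events cs)
  local-orders cs =
    cong (fromMaybe false) (lockstep a≢b a≢c marks-a cs) ,
    cong (fromMaybe false) (lockstep (≢-sym a≢b) b≢c marks-b cs) ,
    cong (fromMaybe false) (lockstep (≢-sym a≢c) (≢-sym b≢c) marks-c cs)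

  feasible-crossings : ∀ is st → EachOnce st → feasible (order st) (events (crossings st is)) ≡ true
  feasible-crossings = crossings-elim (λ st cs → feasible (order st) (events cs) ≡ true) refl
    (λ {pre} {x} {y} {post} {cs} once → feasible-step {pre} {post} {x} {y} once (events cs))

record LocalOrders (n : ℕ) : Set where
  field
    before        : Fin n → Fin n → Fin n → Bool
    before-flip   : ∀ {m u v} → m ≢ u → u ≢ v → before m u v ≡ not (before m v u)
    before-trans  : ∀ {m u v w} → before m u v ≡ true → before m v w ≡ true → before m u w ≡ true
    before-irrefl : ∀ m u → before m u u ≡ false
    before-self   : ∀ m v → before m m v ≡ false
    consistent    : ∀ {a b c} → a F.< b → b F.< c → before b a c ≡ before a b c × before c a b ≡ before a b c

module _ {n : ℕ} (A : Arrangement n) where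

  count-loc : ∀ {m u} → m ≢ u → count u (loc A m) ≡ 1
  count-loc {m} {u} m≢u = trans (count-localSeq (crossSeq A) m≢u) (oncePair A m u m≢u)

  count-loc-self : ∀ m → count m (loc A m) ≡ 0
  count-loc-self m = count-localSeq-self m (crossSeq A) (crossings-proper (swaps A) (allFin n) (allFin-eachOnce n))

  before-consistent : ∀ {a b c} → a F.< b → b F.< c →
    precedes a c (loc A b) ≡ precedes b c (loc A a) × precedes a b (loc A c) ≡ precedes b c (loc A a)
  before-consistent {a} {b} {c} a<b b<c =
    trans on-b (trans (proj₁ agree) (sym on-a)) , trans on-c (trans (proj₂ agree) (sym on-a))
    where
    cs = crossSeq A
    open ThreeWires (<⇒≢ a<b) (<⇒≢ (<-trans a<b b<c)) (<⇒≢ b<c)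
    feasible-events : feasible (true , true , true) (events cs) ≡ true
    feasible-events = subst (λ o → feasible o (events cs) ≡ true)
      (cong₂ _,_ (precedes-allFin a<b) (cong₂ _,_ (precedes-allFin (<-trans a<b b<c)) (precedes-allFin b<c)))
      (feasible-crossings (swaps A) (allFin n) (allFin-eachOnce n))
    count-once : ∀ e → Pairs.count e (events cs) ≡ 1
    count-once e = trans (count-events e cs) (oncePair A _ _ (ends-distinct e))
    agree = event-orders-agree
      (feasible-once (events cs) feasible-events (count-once ab) (count-once ac) (count-once bc))
    on-a = proj₁ (local-orders cs)
    on-b = proj₁ (proj₂ (local-orders cs))
    on-c = proj₂ (proj₂ (local-orders cs))

  localOrders : LocalOrders n
  localOrders = record
    { before        = λ m u v → precedes u v (loc A m)
    ; before-flip   = λ {m} m≢u u≢v → precedes-flip (loc A m) u≢v (λ c → 1+n≢0 (trans (sym (count-loc m≢u)) c))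
    ; before-trans  = λ {m} {u} {v} {w} → precedes-trans u v w (loc A m)
    ; before-irrefl = λ m u → precedes-irrefl u (loc A m)
    ; before-self   = λ m v → precedes-absent m v (loc A m) (count-loc-self m)
    ; consistent    = before-consistent
    }

-- Chirotope and Pasch's axiom

xor-cancelʳ : ∀ {p q} r → p xor r ≡ q xor r → p ≡ q
xor-cancelʳ {true}  {true}  _ _ = refl
xor-cancelʳ {false} {false} _ _ = refl
xor-cancelʳ {true}  {false} true  ()
xor-cancelʳ {true}  {false} false ()
xor-cancelʳ {false} {true}  true  ()
xor-cancelʳ {false} {true}  false ()

module _ where
  open BoolSolver (fromCommutativeRing xor-∧-commutativeRing) _≟ᵇ_ using (solve; _:+_; _:=_; con)

  xor-swap : ∀ p q r → (p xor q) xor r ≡ (p xor r) xor q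
  xor-swap = solve 3 (λ p q r → (p :+ q) :+ r := (p :+ r) :+ q) refl

  -- Sum of the three "between" values of Pasch's lemma, written over the orientations
  -- P Q R of the triples abd, acd, bcd and the index comparisons of d with a, b, c.
  pasch-identity : ∀ P Q R bd dc ad →
    not ((P xor bd) xor (Q xor dc)) xor (not ((P xor ad) xor (R xor dc)) xor not ((Q xor ad) xor (R xor not bd)))
      ≡ false
  pasch-identity = solve 6 (λ P Q R bd dc ad →
    (con true :+ ((P :+ bd) :+ (Q :+ dc))) :+
      ((con true :+ ((P :+ ad) :+ (R :+ dc))) :+ (con true :+ ((Q :+ ad) :+ (R :+ (con true :+ bd)))))
      := con false) refl

_<ᵇ_ : ∀ {n} → Fin n → Fin n → Bool
u <ᵇ v = does (u F.<? v)

<ᵇ-flip : ∀ {n} {u v : Fin n} → u ≢ v → v <ᵇ u ≡ not (u <ᵇ v)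
<ᵇ-flip {u = u} {v} u≢v with <-cmp u v
... | tri< u<v _ _ rewrite dec-true (u F.<? v) u<v = dec-false (v F.<? u) (<-asym u<v)
... | tri≈ _ u≡v _ = ⊥-elim (u≢v u≡v)
... | tri> _ _ v<u rewrite dec-false (u F.<? v) (<-asym v<u) = dec-true (v F.<? u) v<u

module Geometry {n : ℕ} (L : LocalOrders n) where
  open LocalOrders L

  -- The chirotope: correcting by the index order makes it symmetric in m, u, v.
  orientation : Fin n → Fin n → Fin n → Bool
  orientation m u v = before m u v xor (u <ᵇ v)

  before-orientation : ∀ m u v → before m u v ≡ orientation m u v xor (u <ᵇ v)
  before-orientation m u v = sym (trans (xor-assoc (before m u v) _ _)
                                        (trans (cong (before m u v xor_) (xor-same (u <ᵇ v))) (xor-identityʳ _)))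

  orientation-swap₂₃ : ∀ {m u v} → m ≢ u → u ≢ v → orientation m u v ≡ orientation m v u
  orientation-swap₂₃ {m} {u} {v} m≢u u≢v rewrite before-flip m≢u u≢v | <ᵇ-flip (≢-sym u≢v) =
    xor-annihilates-not (before m v u) (v <ᵇ u)

  orientation-sorted : ∀ {p q r} → p F.< q → q F.< r →
    orientation q p r ≡ orientation p q r × orientation r p q ≡ orientation p q r
  orientation-sorted {p} {q} {r} p<q q<r
    rewrite proj₁ (consistent p<q q<r) | proj₂ (consistent p<q q<r)
          | dec-true (p F.<? q) p<q | dec-true (q F.<? r) q<r | dec-true (p F.<? r) (<-trans p<q q<r) = refl , refl

  orientation-swap₁₂ : ∀ {m u v} → m ≢ u → m ≢ v → u ≢ v → orientation m u v ≡ orientation u m v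
  orientation-swap₁₂ {m} {u} {v} m≢u m≢v u≢v with <-cmp m u | <-cmp m v | <-cmp u v
  ... | tri≈ _ m≡u _ | _ | _ = ⊥-elim (m≢u m≡u)
  ... | _ | tri≈ _ m≡v _ | _ = ⊥-elim (m≢v m≡v)
  ... | _ | _ | tri≈ _ u≡v _ = ⊥-elim (u≢v u≡v)
  ... | tri< m<u _ _ | tri< m<v _ _ | tri< u<v _ _ = sym (proj₁ (orientation-sorted m<u u<v))
  ... | tri< m<u _ _ | tri< m<v _ _ | tri> _ _ v<u =
    trans (orientation-swap₂₃ m≢u u≢v) (sym (proj₂ (orientation-sorted m<v v<u)))
  ... | tri< m<u _ _ | tri> _ _ v<m | tri< u<v _ _ = ⊥-elim (<-asym v<m (<-trans m<u u<v))
  ... | tri< m<u _ _ | tri> _ _ v<m | tri> _ _ v<u =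
    trans (orientation-swap₂₃ m≢u u≢v)
      (trans (proj₁ (orientation-sorted v<m m<u))
             (sym (trans (orientation-swap₂₃ (≢-sym m≢u) m≢v) (proj₂ (orientation-sorted v<m m<u)))))
  ... | tri> _ _ u<m | tri< m<v _ _ | _ = proj₁ (orientation-sorted u<m m<v)
  ... | tri> _ _ u<m | tri> _ _ v<m | tri< u<v _ _ =
    trans (proj₂ (orientation-sorted u<v v<m)) (sym (orientation-swap₂₃ (≢-sym m≢u) m≢v))
  ... | tri> _ _ u<m | tri> _ _ v<m | tri> _ _ v<u =
    trans (orientation-swap₂₃ m≢u u≢v)
      (trans (proj₂ (orientation-sorted v<u u<m))
             (sym (trans (orientation-swap₂₃ (≢-sym m≢u) m≢v) (proj₁ (orientation-sorted v<u u<m)))))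

  between : Fin n → Fin n → Fin n → Fin n → Bool
  between m u v w = (before m u w ∧ before m w v) ∨ (before m v w ∧ before m w u)

  between-sym : ∀ m u v w → between m u v w ≡ between m v u w
  between-sym m u v w = ∨-comm (before m u w ∧ before m w v) (before m v w ∧ before m w u)

  between-as-xor : ∀ {m u v w} → m ≢ v → m ≢ w → v ≢ w → w ≢ u →
                   between m u v w ≡ not (before m u w xor before m w v)
  between-as-xor {m} {u} {v} {w} m≢v m≢w v≢w w≢u rewrite before-flip m≢v v≢w | before-flip m≢w w≢u
    with before m u w | before m w v
  ... | true  | true  = refl
  ... | true  | false = refl
  ... | false | true  = refl
  ... | false | false = refl

  pasch : ∀ {a b c d} → a ≢ b → a ≢ c → a ≢ d → b ≢ c → b ≢ d → c ≢ d →
          between a b c d xor (between b a c d xor between c a b d) ≡ false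
  pasch {a} {b} {c} {d} a≢b a≢c a≢d b≢c b≢d c≢d
    rewrite between-as-xor a≢c a≢d c≢d (≢-sym b≢d) | between-as-xor b≢c b≢d c≢d (≢-sym a≢d)
          | between-as-xor (≢-sym b≢c) c≢d b≢d (≢-sym a≢d)
          | before-orientation a b d | before-orientation a d c | before-orientation b a d | before-orientation b d c
          | before-orientation c a d | before-orientation c d b
          | sym (orientation-swap₁₂ a≢b a≢d b≢d)
          | sym (trans (orientation-swap₂₃ a≢d (≢-sym c≢d)) (orientation-swap₁₂ a≢c a≢d c≢d))
          | sym (trans (orientation-swap₂₃ b≢d (≢-sym c≢d))
                  (trans (orientation-swap₁₂ b≢c b≢d c≢d) (orientation-swap₂₃ (≢-sym b≢c) b≢d)))
          | <ᵇ-flip b≢d =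
    pasch-identity (orientation a b d) (orientation a d c) (orientation b d c) (b <ᵇ d) (d <ᵇ c) (a <ᵇ d)

  before-asym : ∀ {m u v} → before m u v ≡ true → before m v u ≡ false
  before-asym {m} {u} {v} uv with before m v u in vu
  ... | false = refl
  ... | true with trans (sym (before-trans uv vu)) (before-irrefl m u)
  ...   | ()

  private
    true≢false : ∀ {b} → b ≡ true → b ≡ false → ⊥
    true≢false refl ()

  between-cases : ∀ {m u v w} → between m u v w ≡ true →
    (before m u w ≡ true × before m w v ≡ true) ⊎ (before m v w ≡ true × before m w u ≡ true)
  between-cases {m} {u} {v} {w} h with before m u w | before m w v | before m v w | before m w u
  ... | true  | true  | _     | _     = inj₁ (refl , refl)
  ... | _     | _     | true  | true  = inj₂ (refl , refl)
  between-cases () | true  | false | true  | false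
  between-cases () | true  | false | false | _
  between-cases () | false | _     | true  | false
  between-cases () | false | _     | false | _

  between-intro₁ : ∀ {m u v w} → before m u w ≡ true → before m w v ≡ true → between m u v w ≡ true
  between-intro₁ uw wv rewrite uw | wv = refl

  between-intro₂ : ∀ {m u v w} → before m v w ≡ true → before m w u ≡ true → between m u v w ≡ true
  between-intro₂ {m} {u} {v} {w} vw wu rewrite vw | wu = ∨-zeroʳ (before m u w ∧ before m w v)

  record Strictly (m u v w : Fin n) : Set where
    field
      w≢m : w ≢ m
      w≢u : w ≢ u
      w≢v : w ≢ v
      u≢v : u ≢ v

  between-distinct : ∀ {m u v w} → between m u v w ≡ true → Strictly m u v w
  between-distinct {m} {u} {v} {w} h with between-cases h
  ... | inj₁ (uw , wv) = record
    { w≢m = λ { refl → true≢false wv (before-self w v) }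
    ; w≢u = λ { refl → true≢false uw (before-irrefl m w) }
    ; w≢v = λ { refl → true≢false wv (before-irrefl m w) }
    ; u≢v = λ { refl → true≢false (before-trans uw wv) (before-irrefl m u) } }
  ... | inj₂ (vw , wu) = record
    { w≢m = λ { refl → true≢false wu (before-self w u) }
    ; w≢u = λ { refl → true≢false wu (before-irrefl m w) }
    ; w≢v = λ { refl → true≢false vw (before-irrefl m w) }
    ; u≢v = λ { refl → true≢false (before-trans vw wu) (before-irrefl m v) } }

  between-false : ∀ {m u v w} → (Strictly m u v w → between m u v w ≡ false) → between m u v w ≡ false
  between-false {m} {u} {v} {w} f with between m u v w in h
  ... | false = refl
  ... | true = f (between-distinct h)

  between-endpointˡ : ∀ m u v → between m u v u ≡ false
  between-endpointˡ m u v = between-false (λ s → ⊥-elim (Strictly.w≢u s refl))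

  between-endpointʳ : ∀ m u v → between m u v v ≡ false
  between-endpointʳ m u v = between-false (λ s → ⊥-elim (Strictly.w≢v s refl))

  between-same-side : ∀ {m p u v} → between m p v u ≡ true → before m u p ≡ before m v p
  between-same-side h with between-cases h
  ... | inj₁ (pu , uv) = trans (before-asym pu) (sym (before-asym (before-trans pu uv)))
  ... | inj₂ (vu , up) = trans up (sym (before-trans vu up))

  between-nested : ∀ {m p q u t} → between m p u t ≡ true → between m p q u ≡ true → between m p q t ≡ true
  between-nested ht hu with between-cases hu | between-cases ht
  ... | inj₁ (pu , uq) | inj₁ (pt , tu) = between-intro₁ pt (before-trans tu uq)
  ... | inj₁ (pu , uq) | inj₂ (ut , tp) = ⊥-elim (true≢false tp (before-asym (before-trans pu ut)))
  ... | inj₂ (qu , up) | inj₁ (pt , tu) = ⊥-elim (true≢false up (before-asym (before-trans pt tu)))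
  ... | inj₂ (qu , up) | inj₂ (ut , tp) = between-intro₂ (before-trans qu ut) tp

  between-convex : ∀ {m x z y w t} → between m x z y ≡ true → between m x z w ≡ true → between m y w t ≡ true →
                   between m x z t ≡ true
  between-convex hy hw ht with between-cases hy | between-cases hw | between-cases ht
  ... | inj₁ (xy , yz) | inj₁ (xw , wz) | inj₁ (yt , tw) = between-intro₁ (before-trans xy yt) (before-trans tw wz)
  ... | inj₁ (xy , yz) | inj₁ (xw , wz) | inj₂ (wt , ty) = between-intro₁ (before-trans xw wt) (before-trans ty yz)
  ... | inj₁ (xy , yz) | inj₂ (zw , wx) | _ =
    ⊥-elim (true≢false (before-trans zw wx) (before-asym (before-trans xy yz)))
  ... | inj₂ (zy , yx) | inj₁ (xw , wz) | _ =
    ⊥-elim (true≢false (before-trans zy yx) (before-asym (before-trans xw wz)))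
  ... | inj₂ (zy , yx) | inj₂ (zw , wx) | inj₁ (yt , tw) = between-intro₂ (before-trans zy yt) (before-trans tw wx)
  ... | inj₂ (zy , yx) | inj₂ (zw , wx) | inj₂ (wt , ty) = between-intro₂ (before-trans zw wt) (before-trans ty yx)

  between-excludes : ∀ {m p q w} → between m p q w ≡ true → between m p w q ≡ false
  between-excludes {m} {p} {q} {w} h with between m p w q in h′
  ... | false = refl
  ... | true with between-cases h | between-cases h′
  ...   | inj₁ (pw , wq) | inj₁ (pq , qw) = ⊥-elim (true≢false qw (before-asym wq))
  ...   | inj₁ (pw , wq) | inj₂ (wq′ , qp) = ⊥-elim (true≢false qp (before-asym (before-trans pw wq)))
  ...   | inj₂ (qw , wp) | inj₁ (pq , qw′) = ⊥-elim (true≢false qw (before-asym (before-trans wp pq)))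
  ...   | inj₂ (qw , wp) | inj₂ (wq , qp) = ⊥-elim (true≢false qw (before-asym wq))

  same-side-between : ∀ {m p z w} → m ≢ z → m ≢ w → p ≢ z → p ≢ w → z ≢ w →
    before m z p ≡ before m w p → between m p w z ≡ false → between m p z w ≡ true
  same-side-between {m} {p} {z} {w} m≢z m≢w p≢z p≢w z≢w same outside = begin
    between m p z w                           ≡⟨ between-as-xor m≢z m≢w z≢w (≢-sym p≢w) ⟩
    not (before m p w xor before m w z)       ≡⟨ cong (λ t → not (before m p w xor t)) (before-flip m≢w (≢-sym z≢w)) ⟩
    not (before m p w xor not (before m z w)) ≡⟨ cong (λ b → not (b xor not (before m z w))) same-order ⟨
    not (before m p z xor not (before m z w)) ≡⟨ cong not (not-distribʳ-xor (before m p z) (before m z w)) ⟨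
    not (not (before m p z xor before m z w)) ≡⟨ cong not (between-as-xor m≢w m≢z (≢-sym z≢w) (≢-sym p≢z)) ⟨
    not (between m p w z)                     ≡⟨ cong not outside ⟩
    true                                      ∎
    where
    open ≡-Reasoning
    same-order : before m p z ≡ before m p w
    same-order = not-injective
      (trans (sym (before-flip m≢z (≢-sym p≢z))) (trans same (before-flip m≢w (≢-sym p≢w))))

  pasch-third : ∀ {a b c d} → a ≢ b → a ≢ c → a ≢ d → b ≢ c → b ≢ d → c ≢ d →
                between c a b d ≡ between a b c d xor between b a c d
  pasch-third {a} {b} {c} {d} a≢b a≢c a≢d b≢c b≢d c≢d with pasch a≢b a≢c a≢d b≢c b≢d c≢d
  ... | even with between a b c d | between b a c d | between c a b d
  ...   | true  | true  | false = refl
  ...   | true  | false | true  = refl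
  ...   | false | true  | true  = refl
  ...   | false | false | false = refl

  -- Whether the crossing of x and y lies above ℓ: wire x starts above ℓ exactly when ℓ < x.
  above : Fin n → Fin n → Fin n → Bool
  above ℓ x y = before x y ℓ xor (x <ᵇ ℓ)

  above-sym : ∀ {ℓ x y} → ℓ ≢ x → ℓ ≢ y → x ≢ y → above ℓ x y ≡ above ℓ y x
  above-sym {ℓ} {x} {y} ℓ≢x ℓ≢y x≢y
    rewrite before-orientation x y ℓ | before-orientation y x ℓ
          | orientation-swap₁₂ x≢y (≢-sym ℓ≢x) (≢-sym ℓ≢y) = xor-swap (orientation y x ℓ) (y <ᵇ ℓ) (x <ᵇ ℓ)

  -- Line y cuts the triangle ℓ x z through its side on ℓ but not through its side on x.
  module Cut {ℓ x z y} (ℓ≢x : ℓ ≢ x) (ℓ≢z : ℓ ≢ z)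
             (on-ℓ : between ℓ x z y ≡ true) (off-x : between x ℓ z y ≡ false) where
    open Strictly (between-distinct on-ℓ) public renaming (w≢m to y≢ℓ; w≢u to y≢x; w≢v to y≢z; u≢v to x≢z)

    on-z : between z ℓ x y ≡ true
    on-z = trans (pasch-third ℓ≢x ℓ≢z (≢-sym y≢ℓ) x≢z (≢-sym y≢x) (≢-sym y≢z)) (cong₂ _xor_ on-ℓ off-x)

    above-cut : above ℓ y z ≡ above ℓ x z
    above-cut = begin
      above ℓ y z                 ≡⟨ above-sym (≢-sym y≢ℓ) ℓ≢z y≢z ⟩
      before z y ℓ xor (z <ᵇ ℓ)   ≡⟨ cong (_xor (z <ᵇ ℓ)) (between-same-side on-z) ⟩
      before z x ℓ xor (z <ᵇ ℓ)   ≡⟨ above-sym ℓ≢z ℓ≢x (≢-sym x≢z) ⟩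
      above ℓ x z                 ∎
      where open ≡-Reasoning

    x-outside : between y ℓ z x ≡ false
    x-outside = trans (pasch-third ℓ≢z (≢-sym y≢ℓ) ℓ≢x (≢-sym y≢z) (≢-sym x≢z) y≢x)
      (cong₂ _xor_ (between-excludes (trans (between-sym ℓ z x y) on-ℓ)) (between-excludes on-z))

    nested-cut : ∀ {w} → between x ℓ z w ≡ false → between y ℓ z w ≡ true → between ℓ x z w ≡ true
    nested-cut {w} off-x′ cut with between-distinct cut
    ... | record { w≢m = w≢y ; w≢u = w≢ℓ ; w≢v = w≢z }
      with between ℓ z y w in on-ℓ-zy | between z ℓ y w in on-z-ℓy
         | trans (sym cut) (pasch-third ℓ≢z (≢-sym y≢ℓ) (≢-sym w≢ℓ) (≢-sym y≢z) (≢-sym w≢z) (≢-sym w≢y))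
    ... | true | _ | _ = trans (between-sym ℓ x z w) (between-nested on-ℓ-zy (trans (between-sym ℓ z x y) on-ℓ))
    ... | false | true | _ = begin
      between ℓ x z w                      ≡⟨ sym (xor-identityʳ _) ⟩
      between ℓ x z w xor false            ≡⟨ cong (between ℓ x z w xor_) (sym off-x′) ⟩
      between ℓ x z w xor between x ℓ z w  ≡⟨ pasch-third ℓ≢x ℓ≢z (≢-sym w≢ℓ) x≢z (≢-sym w≢x) (≢-sym w≢z) ⟨
      between z ℓ x w                      ≡⟨ between-nested on-z-ℓy on-z ⟩
      true                                 ∎
      where
      open ≡-Reasoning
      w≢x : w ≢ x
      w≢x refl = true≢false cut x-outside
    ... | false | false | ()

-- Levi's lemma

descend : ∀ {X : Set} {P : X → Set} {Q : Set} (μ : X → ℕ) →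
          (∀ {x} → P x → Q ⊎ Σ[ x′ ∈ X ] P x′ × μ x′ < μ x) → ∀ {x} → P x → Q
descend {X} {P} {Q} μ step {x} = go (<-wellFounded (μ x))
  where
  go : ∀ {x} → Acc _<_ (μ x) → P x → Q
  go (acc smaller) px with step px
  ... | inj₁ q = q
  ... | inj₂ (x′ , px′ , μx′<μx) = go (smaller μx′<μx) px′

module Levi {n : ℕ} (L : LocalOrders n) where
  open Geometry L

  interval : Fin n → Fin n → Fin n → Subset.Subset n
  interval m u v = Vec.tabulate (between m u v)

  width : Fin n → Fin n → Fin n → ℕ
  width m u v = Subset.∣ interval m u v ∣

  width-shrinks : ∀ {m u v u′ v′ y} → (∀ t → between m u′ v′ t ≡ true → between m u v t ≡ true) →
    between m u v y ≡ true → between m u′ v′ y ≡ false → width m u′ v′ < width m u v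
  width-shrinks {m} {u} {v} {u′} {v′} {y} sub y-in y-out = p⊂q⇒∣p∣<∣q∣ (⊆ , y , ∈-interval y-in , ∉)
    where
    ∈-interval : ∀ {a b t} → between m a b t ≡ true → t Subset.∈ interval m a b
    ∈-interval {a} {b} {t} h = lookup⇒[]= t (interval m a b) (trans (lookup∘tabulate (between m a b) t) h)
    interval-∈ : ∀ {a b t} → t Subset.∈ interval m a b → between m a b t ≡ true
    interval-∈ {a} {b} {t} t∈ = trans (sym (lookup∘tabulate (between m a b) t)) ([]=⇒lookup t∈)
    ⊆ : ∀ {t} → t Subset.∈ interval m u′ v′ → t Subset.∈ interval m u v
    ⊆ {t} t∈ = ∈-interval (sub t (interval-∈ t∈))
    ∉ : ¬ y Subset.∈ interval m u′ v′
    ∉ y∈ with trans (sym (interval-∈ y∈)) y-out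
    ... | ()

  record EmptyTriangle (a b c : Fin n) : Set where
    field
      a≢b : a ≢ b
      a≢c : a ≢ c
      b≢c : b ≢ c
      side-a : ∀ v → between a b c v ≡ false
      side-b : ∀ v → between b a c v ≡ false
      side-c : ∀ v → between c a b v ≡ false

  private
    find-between : ∀ m u v → (∀ w → between m u v w ≡ false) ⊎ ∃[ w ] between m u v w ≡ true
    find-between m u v with any? (λ w → between m u v w ≟ᵇ true)
    ... | yes found = inj₂ found
    ... | no none = inj₁ (λ w → ¬-not (λ h → none (w , h)))

  module Side (ℓ : Fin n) (s : Bool) where

    OnSide : Fin n → Fin n → Set
    OnSide x v = v ≢ ℓ × v ≢ x × above ℓ x v ≡ s

    Nearest : Fin n → Fin n → Set
    Nearest x z = OnSide x z × (∀ v → between x ℓ z v ≡ false)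

    nearest : ∀ {x v} → OnSide x v → ∃[ z ] Nearest x z
    nearest {x} = descend (λ v → width x ℓ v) step
      where
      step : ∀ {v} → OnSide x v → (∃[ z ] Nearest x z) ⊎ Σ[ u ∈ Fin n ] OnSide x u × width x ℓ u < width x ℓ v
      step {v} on-v with find-between x ℓ v
      ... | inj₁ none = inj₁ (v , on-v , none)
      ... | inj₂ (u , closer) =
        inj₂ (u , on-u , width-shrinks (λ t ht → between-nested ht closer) closer (between-endpointʳ x ℓ u))
        where
        open Strictly (between-distinct closer)
        on-u : OnSide x u
        on-u = w≢u , w≢m , trans (cong (_xor (x <ᵇ ℓ)) (between-same-side closer)) (proj₂ (proj₂ on-v))

    Candidate : Fin n × Fin n → Set
    Candidate (x , z) = x ≢ ℓ × Nearest x z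

    Narrower : Fin n × Fin n → Set
    Narrower (x , z) = Σ[ (y , w) ∈ Fin n × Fin n ] Candidate (y , w) × width ℓ y w < width ℓ x z

    empty-triangle : ∀ {p} → Candidate p → Σ[ (x , z) ∈ Fin n × Fin n ] EmptyTriangle ℓ x z
    empty-triangle = descend (λ (x , z) → width ℓ x z) step
      where
      step : ∀ {p} → Candidate p → (Σ[ (x , z) ∈ Fin n × Fin n ] EmptyTriangle ℓ x z) ⊎ Narrower p
      step {x , z} (x≢ℓ , (z≢ℓ , z≢x , side) , near) with find-between ℓ x z
      ... | inj₁ none = inj₁ ((x , z) , record
        { a≢b = ≢-sym x≢ℓ ; a≢c = ≢-sym z≢ℓ ; b≢c = ≢-sym z≢x ; side-a = none ; side-b = near
        ; side-c = λ v → between-false λ s → let open Strictly s in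
            trans (pasch-third (≢-sym x≢ℓ) (≢-sym z≢ℓ) (≢-sym w≢u) (≢-sym z≢x) (≢-sym w≢v) (≢-sym w≢m))
                  (cong₂ _xor_ (none v) (near v)) })
      ... | inj₂ (y , on-ℓ) = inj₂ (next (nearest on-y-z))
        where
        open Cut (≢-sym x≢ℓ) (≢-sym z≢ℓ) on-ℓ (near y)
        on-y-z : OnSide y z
        on-y-z = z≢ℓ , ≢-sym y≢z , trans above-cut side
        next : ∃[ w ] Nearest y w → Narrower (x , z)
        next (w , near-w@((w≢ℓ , w≢y , side-w) , _)) with w F.≟ z
        ... | yes refl = (y , z) , (y≢ℓ , near-w) ,
          width-shrinks (λ t ht → trans (between-sym ℓ x z t)
                                    (between-nested (trans (between-sym ℓ z y t) ht) (trans (between-sym ℓ z x y) on-ℓ)))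
                        on-ℓ (between-endpointˡ ℓ y z)
        ... | no w≢z = (y , w) , (y≢ℓ , near-w) ,
          width-shrinks (λ t → between-convex on-ℓ w-inside) on-ℓ (between-endpointˡ ℓ y w)
          where
          y-cut : between y ℓ z w ≡ true
          y-cut = same-side-between y≢z (≢-sym w≢y) (≢-sym z≢ℓ) (≢-sym w≢ℓ) (≢-sym w≢z)
                    (xor-cancelʳ (y <ᵇ ℓ) (trans (proj₂ (proj₂ on-y-z)) (sym side-w))) (proj₂ near-w z)
          w-inside : between ℓ x z w ≡ true
          w-inside = nested-cut (near w) y-cut

  triangle-at : ∀ {ℓ x v} → x ≢ ℓ → v ≢ ℓ → v ≢ x → Σ[ (x , z) ∈ Fin n × Fin n ] EmptyTriangle ℓ x z
  triangle-at {ℓ} {x} {v} x≢ℓ v≢ℓ v≢x = empty-triangle (x≢ℓ , proj₂ (nearest (v≢ℓ , v≢x , refl)))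
    where open Side ℓ (above ℓ x v)

two-others : ∀ {n} → 3 ≤ n → (ℓ : Fin n) → Σ[ x ∈ Fin n ] Σ[ v ∈ Fin n ] x ≢ ℓ × v ≢ ℓ × v ≢ x
two-others {suc (suc (suc _))} (s≤s (s≤s (s≤s _))) ℓ =
  F.punchIn ℓ zero , F.punchIn ℓ (suc zero) , punchInᵢ≢i ℓ zero , punchInᵢ≢i ℓ (suc zero) ,
  (λ ()) ∘ punchIn-injective ℓ (suc zero) zero

module _ {n : ℕ} (A : Arrangement n) where
  open Geometry (localOrders A)
  open Levi (localOrders A)

  count-loc-≤1 : ∀ m w → count w (loc A m) ≤ 1
  count-loc-≤1 m w with m F.≟ w
  ... | yes refl rewrite count-loc-self A m = z≤n
  ... | no m≢w rewrite count-loc A m≢w = ≤-refl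

  consec-if-nothing-between : ∀ {m u v} → m ≢ u → m ≢ v → u ≢ v → (∀ w → between m u v w ≡ false) →
                              Consec u v (loc A m)
  consec-if-nothing-between {m} m≢u m≢v u≢v none =
    adjacent-if-nothing-between (loc A m) u≢v (count-loc A m≢u) (count-loc A m≢v) (count-loc-≤1 m) none

  sorted-triangle : ∀ {a b c} → a ≢ b → a ≢ c → b ≢ c →
    Consec b c (loc A a) → Consec a c (loc A b) → Consec a b (loc A c) →
    Σ[ t ∈ Triple n ] IsTriangle A t × Involves t a
  sorted-triangle {a} {b} {c} a≢b a≢c b≢c on-a on-b on-c with <-cmp a b | <-cmp a c | <-cmp b c
  ... | tri≈ _ a≡b _ | _ | _ = ⊥-elim (a≢b a≡b)
  ... | _ | tri≈ _ a≡c _ | _ = ⊥-elim (a≢c a≡c)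
  ... | _ | _ | tri≈ _ b≡c _ = ⊥-elim (b≢c b≡c)
  ... | tri< a<b _ _ | tri< a<c _ _ | tri< b<c _ _ = (a , b , c) , (a<b , b<c , on-a , on-b , on-c) , inj₁ refl
  ... | tri< a<b _ _ | tri< a<c _ _ | tri> _ _ c<b = (a , c , b) , (a<c , c<b , adjacent-sym on-a , on-c , on-b) , inj₁ refl
  ... | tri< a<b _ _ | tri> _ _ c<a | tri< b<c _ _ = ⊥-elim (<-asym c<a (<-trans a<b b<c))
  ... | tri< a<b _ _ | tri> _ _ c<a | tri> _ _ c<b =
    (c , a , b) , (c<a , a<b , on-c , adjacent-sym on-a , adjacent-sym on-b) , inj₂ (inj₁ refl)
  ... | tri> _ _ b<a | tri< a<c _ _ | tri< b<c _ _ =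
    (b , a , c) , (b<a , a<c , on-b , on-a , adjacent-sym on-c) , inj₂ (inj₁ refl)
  ... | tri> _ _ b<a | tri< a<c _ _ | tri> _ _ c<b = ⊥-elim (<-asym c<b (<-trans b<a a<c))
  ... | tri> _ _ b<a | tri> _ _ c<a | tri< b<c _ _ =
    (b , c , a) , (b<c , c<a , adjacent-sym on-b , adjacent-sym on-c , on-a) , inj₂ (inj₂ refl)
  ... | tri> _ _ b<a | tri> _ _ c<a | tri> _ _ c<b =
    (c , b , a) , (c<b , b<a , adjacent-sym on-c , adjacent-sym on-b , adjacent-sym on-a) , inj₂ (inj₂ refl)

  triangle-through : 3 ≤ n → (ℓ : Fin n) → Σ[ t ∈ Triple n ] IsTriangle A t × Involves t ℓ
  triangle-through 3≤n ℓ with two-others 3≤n ℓ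
  ... | x , v , x≢ℓ , v≢ℓ , v≢x with triangle-at x≢ℓ v≢ℓ v≢x
  ...   | _ , empty = sorted-triangle a≢b a≢c b≢c
                        (consec-if-nothing-between a≢b a≢c b≢c side-a)
                        (consec-if-nothing-between (≢-sym a≢b) b≢c a≢c side-b)
                        (consec-if-nothing-between (≢-sym a≢c) (≢-sym b≢c) a≢b side-c)
    where open EmptyTriangle empty

-- Greedy choice of triangles

module _ {n : ℕ} where

  involves? : (t : Triple n) → Decidable (Involves t)
  involves? (a , b , c) ℓ = ℓ F.≟ a ⊎-dec ℓ F.≟ b ⊎-dec ℓ F.≟ c

  component : Triple n → Fin 3 → Fin n
  component (a , b , c) zero = a
  component (a , b , c) (suc zero) = b
  component (a , b , c) (suc (suc zero)) = c

  position : ∀ t {u} → Involves t u → Σ[ p ∈ Fin 3 ] component t p ≡ u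
  position (a , b , c) (inj₁ refl) = zero , refl
  position (a , b , c) (inj₂ (inj₁ refl)) = suc zero , refl
  position (a , b , c) (inj₂ (inj₂ refl)) = suc (suc zero) , refl

  record Cover (Good : Triple n → Set) (S : List (Fin n)) : Set where
    field
      k        : ℕ
      ts       : Vec (Triple n) k
      ls       : Vec (Fin n) k
      good     : ∀ i → Good (lookup ts i)
      involves : ∀ i → Involves (lookup ts i) (lookup ls i)
      first    : ∀ i j → j <ᶠ i → ¬ Involves (lookup ts j) (lookup ls i)
      covers   : ∀ {u} → u ∈ S → ∃[ i ] Involves (lookup ts i) u
      drawn    : ∀ i → lookup ls i ∈ S

    triangles-distinct : ∀ i j → lookup ts i ≡ lookup ts j → i ≡ j
    triangles-distinct i j eq with <-cmp i j
    ... | tri< i<j _ _ = ⊥-elim (first j i i<j (subst (λ t → Involves t (lookup ls j)) (sym eq) (involves j)))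
    ... | tri≈ _ i≡j _ = i≡j
    ... | tri> _ _ j<i = ⊥-elim (first i j j<i (subst (λ t → Involves t (lookup ls i)) eq (involves i)))

    lines-distinct : ∀ i j → lookup ls i ≡ lookup ls j → i ≡ j
    lines-distinct i j eq with <-cmp i j
    ... | tri< i<j _ _ = ⊥-elim (first j i i<j (subst (Involves (lookup ts i)) eq (involves i)))
    ... | tri≈ _ i≡j _ = i≡j
    ... | tri> _ _ j<i = ⊥-elim (first i j j<i (subst (Involves (lookup ts j)) (sym eq) (involves j)))

    size-bound : (∀ u → u ∈ S) → n ≤ 3 * k
    size-bound all∈S = subst (n ≤_) (*-comm k 3) (injective⇒≤ {f = slot} slot-injective)
      where
      slot : Fin n → Fin (k * 3)
      slot u = F.combine (proj₁ (covers (all∈S u))) (proj₁ (position _ (proj₂ (covers (all∈S u)))))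
      slot-injective : ∀ {u v} → slot u ≡ slot v → u ≡ v
      slot-injective {u} {v} eq with covers (all∈S u) | covers (all∈S v)
      ... | i , iu | j , jv with position (lookup ts i) iu | position (lookup ts j) jv | combine-injective i _ j _ eq
      ...   | p , refl | q , refl | refl , refl = refl

  greedy : ∀ {Good : Triple n → Set} → ((ℓ : Fin n) → Σ[ t ∈ Triple n ] Good t × Involves t ℓ) →
           ∀ S → Cover Good S
  greedy {Good} choose S = go (length S) S ≤-refl
    where
    go : ∀ fuel S → length S ≤ fuel → Cover Good S
    go _ [] _ = record { k = 0 ; ts = [] ; ls = [] ; good = λ () ; involves = λ () ; first = λ ()
                       ; covers = λ () ; drawn = λ () }
    go (suc fuel) (ℓ ∷ S) (s≤s len) = record
      { k = suc k ; ts = t ∷ ts ; ls = ℓ ∷ ls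
      ; good = λ { zero → proj₁ (proj₂ (choose ℓ)) ; (suc i) → good i }
      ; involves = λ { zero → proj₂ (proj₂ (choose ℓ)) ; (suc i) → involves i }
      ; first = λ { (suc i) zero _ → proj₂ (∈-filter⁻ uncovered {xs = S} (drawn i))
                  ; (suc i) (suc j) (s≤s j<i) → first i j j<i }
      ; covers = λ { (here refl) → zero , proj₂ (proj₂ (choose ℓ)) ; (there u∈S) → cover-rest u∈S }
      ; drawn = λ { zero → here refl ; (suc i) → there (proj₁ (∈-filter⁻ uncovered {xs = S} (drawn i))) } }
      where
      t = proj₁ (choose ℓ)
      uncovered = ¬? ∘ involves? t
      rest = go fuel (filter uncovered S) (≤-trans (length-filter uncovered S) len)
      open Cover rest
      cover-rest : ∀ {u} → u ∈ S → ∃[ i ] Involves (lookup (t ∷ ts) i) u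
      cover-rest {u} u∈S with involves? t u
      ... | yes tu = zero , tu
      ... | no ¬tu with covers (∈-filter⁺ uncovered u∈S ¬tu)
      ...   | i , iu = suc i , iu

lemma7 : (n : ℕ) → 3 ≤ n → (A : Arrangement n) →
    Σ ℕ (λ k → Σ (Vec (Triple n) k) (λ ts → Σ (Vec (Fin n) k) (λ ls →
      (n ≤ 3 * k)
      × ((i j : Fin k) → lookup ts i ≡ lookup ts j → i ≡ j)
      × ((i j : Fin k) → lookup ls i ≡ lookup ls j → i ≡ j)
      × ((i : Fin k) → IsTriangle A (lookup ts i))
      × ((i : Fin k) → Involves (lookup ts i) (lookup ls i)
           × ((j : Fin k) → j <ᶠ i → ¬ Involves (lookup ts j) (lookup ls i))))))
lemma7 n 3≤n A =
  k , ts , ls , size-bound ∈-allFin , triangles-distinct , lines-distinct , good , λ i → involves i , first i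
  where open Cover (greedy (triangle-through A 3≤n) (allFin n))
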